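{- Every separable permutation $\sigma=\sigma_1\cdots\sigma_n$ of length $n\ge2$ has at least one index $i$ with $|\sigma_i-\sigma_{i+1}|=1$ or $|\sigma_{i-1}-\sigma_i|=1$ (ignoring nonexistent entries). That is, apart from the empty permutation and the permutation $1$, no separable permutation avoids the 1-box pattern.
   Context: A permutation is separable if it avoids both patterns $2413$ and $3142$, i.e., it has no subsequence $\sigma_{i_1}\sigma_{i_2}\sigma_{i_3}\sigma_{i_4}$ ($i_1<i_2<i_3<i_4$) order-isomorphic to $2413$ or to $3142$. An index $i$ as in the claim is called an occurrence of the 1-box pattern. -}

module Defs where

open import Data.Nat using (ℕ; suc)
open import Data.Fin using (Fin; toℕ; _<_)
open import Data.Fin.Permutation using (Permutation′; _⟨$⟩ʳ_)
open import Data.Product using (Σ; ∃; _×_)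
open import Data.Sum using (_⊎_)
open import Relation.Binary.PropositionalEquality using (_≡_)
open import Relation.Nullary using (¬_)

Contains2413 : {n : ℕ} → Permutation′ n → Set
Contains2413 {n} σ =
  Σ (Fin n) λ i₁ → Σ (Fin n) λ i₂ → Σ (Fin n) λ i₃ → Σ (Fin n) λ i₄ →
    (i₁ < i₂) × (i₂ < i₃) × (i₃ < i₄) ×
    ((σ ⟨$⟩ʳ i₃) < (σ ⟨$⟩ʳ i₁)) × ((σ ⟨$⟩ʳ i₁) < (σ ⟨$⟩ʳ i₄)) × ((σ ⟨$⟩ʳ i₄) < (σ ⟨$⟩ʳ i₂))

Contains3142 : {n : ℕ} → Permutation′ n → Set
Contains3142 {n} σ =
  Σ (Fin n) λ i₁ → Σ (Fin n) λ i₂ → Σ (Fin n) λ i₃ → Σ (Fin n) λ i₄ →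
    (i₁ < i₂) × (i₂ < i₃) × (i₃ < i₄) ×
    ((σ ⟨$⟩ʳ i₂) < (σ ⟨$⟩ʳ i₄)) × ((σ ⟨$⟩ʳ i₄) < (σ ⟨$⟩ʳ i₁)) × ((σ ⟨$⟩ʳ i₁) < (σ ⟨$⟩ʳ i₃))

Separable : {n : ℕ} → Permutation′ n → Set
Separable σ = ¬ Contains2413 σ × ¬ Contains3142 σ

Differ1 : {n : ℕ} → Fin n → Fin n → Set
Differ1 a b = toℕ a ≡ suc (toℕ b) ⊎ toℕ b ≡ suc (toℕ a)

OneBoxAt : {n : ℕ} → Permutation′ n → Fin n → Set
OneBoxAt {n} σ i =
  (Σ (Fin n) λ j → (toℕ j ≡ suc (toℕ i)) × Differ1 (σ ⟨$⟩ʳ i) (σ ⟨$⟩ʳ j))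
  ⊎ (Σ (Fin n) λ j → (suc (toℕ j) ≡ toℕ i) × Differ1 (σ ⟨$⟩ʳ j) (σ ⟨$⟩ʳ i))

-- A separable permutation of length at least 2 is a direct or skew sum of two
-- shorter ones: every window of at least two positions has a split point with all
-- entries on its left below, or all above, those on its right.  Hence a block (a
-- window whose entries form an interval of values) of length at least 2 has a
-- sub-block on one side of the split that still has length at least 2.
-- Descending from the whole permutation ends in a block of two adjacent
-- positions, and their values, forming an interval, differ by 1.
module Submission where

open import Defs
open import Data.Empty using (⊥; ⊥-elim)
open import Data.Fin as Fin using (Fin; toℕ; fromℕ<)
open import Data.Fin.Permutation using (Permutation′; _⟨$⟩ʳ_; _⟨$⟩ˡ_; inverseʳ)
open import Data.Fin.Properties using (toℕ-fromℕ<; fromℕ<-toℕ; fromℕ<-injective; toℕ-injective; toℕ<n)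
open import Data.Nat using (ℕ; zero; suc; _≤_; _<_; _>_; _∸_; z≤n; s≤s⁻¹; _≤?_; _<?_)
open import Data.Nat.Induction using (<-wellFounded)
open import Data.Nat.Properties
open import Data.Product using (∃; _×_; _,_; proj₁; proj₂)
open import Data.Sum using (_⊎_; inj₁; inj₂; swap)
import Data.Sum as Sum
open import Function.Base using (flip)
open import Function.Bundles using (Injection)
open import Function.Properties.Inverse using (Inverse⇒Injection)
open import Induction.WellFounded using (Acc; acc)
open import Level using (0ℓ)
open import Relation.Binary.Core using (Rel)
open import Relation.Binary.Definitions using (tri<; tri≈; tri>)
open import Relation.Binary.Structures using (IsStrictTotalOrder)
import Relation.Binary.Construct.Flip.EqAndOrd as Flip
open import Relation.Binary.PropositionalEquality
open import Relation.Nullary using (¬_; yes; no)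
open import Relation.Unary using (Pred; Decidable)

first-in-range : {P : Pred ℕ 0ℓ} → Decidable P → ∀ a b →
  (∀ {j} → a ≤ j → j < b → ¬ P j) ⊎
  ∃ λ j → a ≤ j × j < b × P j × (∀ {i} → a ≤ i → i < j → ¬ P i)
first-in-range P? a zero = inj₁ λ _ ()
first-in-range P? a (suc b) with first-in-range P? a b
... | inj₂ (j , a≤j , j<b , Pj , first) = inj₂ (j , a≤j , m<n⇒m<1+n j<b , Pj , first)
... | inj₁ none with a ≤? b | P? b
...   | no a≰b  | _      = inj₁ λ a≤j j≤b _ → a≰b (≤-trans a≤j (s≤s⁻¹ j≤b))
...   | yes _   | no ¬Pb = inj₁ λ a≤j j≤b →
                             Sum.[ none a≤j , (λ { refl → ¬Pb }) ] (m<1+n⇒m<n∨m≡n j≤b)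
...   | yes a≤b | yes Pb = inj₂ (b , a≤b , n<1+n b , Pb , none)

window-of-two : ∀ {i j} → i ≤ j → j < suc (suc i) → j ≡ i ⊎ j ≡ suc i
window-of-two i≤j j<i+2 = Sum.map₁ (λ j<i+1 → ≤-antisym (s≤s⁻¹ j<i+1) i≤j) (m<1+n⇒m<n∨m≡n j<i+2)

module Windows (n : ℕ) (f : ℕ → ℕ) where

  Splits : Rel ℕ 0ℓ → ℕ → ℕ → ℕ → Set
  Splits R l k r = ∀ {i j} → l ≤ i → i < k → k ≤ j → j < r → R (f i) (f j)

  Separates : ℕ → ℕ → ℕ → Set
  Separates l k r = Splits _<_ l k r ⊎ Splits _>_ l k r

  -- Avoids3142 _>_ is avoidance of the complementary pattern 2413.
  Avoids3142 : Rel ℕ 0ℓ → Set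
  Avoids3142 R = ∀ {i₁ i₂ i₃ i₄} → i₁ < i₂ → i₂ < i₃ → i₃ < i₄ → i₄ < n →
    R (f i₂) (f i₄) → R (f i₄) (f i₁) → R (f i₁) (f i₃) → ⊥

  Block : ℕ → ℕ → Set
  Block l r = ∀ {a b j} → l ≤ a → a < r → l ≤ b → b < r → j < n →
    f a < f j → f j < f b → l ≤ j × j < r

  whole-block : Block 0 n
  whole-block _ _ _ _ j<n _ _ = z≤n , j<n

  splits-nothing : ∀ {R l r} → Splits R l r r
  splits-nothing _ _ r≤j j<r = ⊥-elim (<⇒≱ j<r r≤j)

  splits-extendʳ : ∀ R {l k r} → Splits R l k r →
    (∀ {i} → l ≤ i → i < k → R (f i) (f r)) → Splits R l k (suc r)
  splits-extendʳ _ split last l≤i i<k k≤j j≤r with m<1+n⇒m<n∨m≡n j≤r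
  ... | inj₁ j<r  = split l≤i i<k k≤j j<r
  ... | inj₂ refl = last l≤i i<k

  splits-pair : ∀ {R l} → R (f l) (f (suc l)) → Splits R l (suc l) (suc (suc l))
  splits-pair {R} {l} fl<fl+1 = splits-extendʳ R (splits-nothing {R}) first
    where
    first : ∀ {i} → l ≤ i → i < suc l → R (f i) (f (suc l))
    first l≤i i≤l with ≤-antisym (s≤s⁻¹ i≤l) l≤i
    ... | refl = fl<fl+1

  block-left : ∀ {l k r} → k ≤ r → Separates l k r → Block l r → Block l k
  block-left {k = k} k≤r sep block {j = j} l≤a a<k l≤b b<k j<n fa<fj fj<fb
    with block l≤a (<-≤-trans a<k k≤r) l≤b (<-≤-trans b<k k≤r) j<n fa<fj fj<fb
  ... | l≤j , j<r with k ≤? j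
  ...   | no k≰j = l≤j , ≰⇒> k≰j
  ...   | yes k≤j with sep
  ...     | inj₁ split = ⊥-elim (<-asym fj<fb (split l≤b b<k k≤j j<r))
  ...     | inj₂ split = ⊥-elim (<-asym fa<fj (split l≤a a<k k≤j j<r))

  block-right : ∀ {l k r} → l ≤ k → Separates l k r → Block l r → Block k r
  block-right {k = k} l≤k sep block {j = j} k≤a a<r k≤b b<r j<n fa<fj fj<fb
    with block (≤-trans l≤k k≤a) a<r (≤-trans l≤k k≤b) b<r j<n fa<fj fj<fb
  ... | l≤j , j<r with k ≤? j
  ...   | yes k≤j = k≤j , j<r
  ...   | no k≰j with sep
  ...     | inj₁ split = ⊥-elim (<-asym fa<fj (split l≤j (≰⇒> k≰j) k≤a a<r))
  ...     | inj₂ split = ⊥-elim (<-asym fj<fb (split l≤j (≰⇒> k≰j) k≤b b<r))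

  two-point-block-gap : ∀ {l r a b} → Block l r → l ≤ a → a < r → l ≤ b → b < r →
    (∀ {j} → l ≤ j → j < r → j ≡ a ⊎ j ≡ b) →
    ∀ {j} → j < n → f a < f j → f j < f b → ⊥
  two-point-block-gap block l≤a a<r l≤b b<r two j<n fa<fj fj<fb
    with block l≤a a<r l≤b b<r j<n fa<fj fj<fb
  ... | l≤j , j<r with two l≤j j<r
  ...   | inj₁ refl = <-irrefl refl fa<fj
  ...   | inj₂ refl = <-irrefl refl fj<fb

  two-point-block-consecutive : (∀ {i c} → i < n → c < f i → ∃ λ j → j < n × f j ≡ c) →
    ∀ {l r a b} → Block l r → l ≤ a → a < r → l ≤ b → b < r → b < n →
    (∀ {j} → l ≤ j → j < r → j ≡ a ⊎ j ≡ b) → f a < f b → f b ≡ suc (f a)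
  two-point-block-consecutive closed {a = a} {b} block l≤a a<r l≤b b<r b<n two fa<fb
    with m≤n⇒m<n∨m≡n fa<fb
  ... | inj₂ fa+1≡fb = sym fa+1≡fb
  ... | inj₁ fa+1<fb with closed b<n fa+1<fb
  ...   | j , j<n , fj≡fa+1 = ⊥-elim (two-point-block-gap block l≤a a<r l≤b b<r two j<n
                                 (subst (f a <_) (sym fj≡fa+1) (n<1+n (f a)))
                                 (subst (_< f b) (sym fj≡fa+1) fa+1<fb))

  module _ (f-injective : ∀ {i j} → i < n → j < n → f i ≡ f j → i ≡ j) where

    f-distinct : ∀ {i j} → i < j → j < n → f i ≢ f j
    f-distinct i<j j<n e = <-irrefl (f-injective (<-trans i<j j<n) j<n e) i<j

    module _ {R : Rel ℕ 0ℓ} (R-isStrictTotalOrder : IsStrictTotalOrder _≡_ R) where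
      open IsStrictTotalOrder R-isStrictTotalOrder
        using (compare) renaming (trans to R-trans; _<?_ to _R?_)

      R-connex : ∀ {i j} → i < j → j < n → R (f i) (f j) ⊎ R (f j) (f i)
      R-connex {i} {j} i<j j<n with compare (f i) (f j)
      ... | tri< fi<fj _ _ = inj₁ fi<fj
      ... | tri≈ _ fi≡fj _ = ⊥-elim (f-distinct i<j j<n fi≡fj)
      ... | tri> _ _ fj<fi = inj₂ fj<fi

      below-of-not-above : ∀ {i j} → i < j → j < n → ¬ R (f j) (f i) → R (f i) (f j)
      below-of-not-above i<j j<n fj≮fi with R-connex i<j j<n
      ... | inj₁ fi<fj = fi<fj
      ... | inj₂ fj<fi = ⊥-elim (fj≮fi fj<fi)

      module _ (avoids : Avoids3142 R) where

        above-last-onwards : ∀ {l k r k′} → Splits R l k r → k < r → r < n →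
          l ≤ k′ → k′ < k → R (f r) (f k′) → ∀ {j} → k′ ≤ j → j < r → R (f r) (f j)
        above-last-onwards {k = k} split k<r r<n l≤k′ k′<k fr<fk′ {j} k′≤j j<r
          with k ≤? j | m≤n⇒m<n∨m≡n k′≤j
        ... | yes k≤j | _         = R-trans fr<fk′ (split l≤k′ k′<k k≤j j<r)
        ... | no _    | inj₂ refl = fr<fk′
        ... | no k≰j  | inj₁ k′<j with R-connex j<r r<n
        ...   | inj₂ fr<fj = fr<fj
        ...   | inj₁ fj<fr =
          ⊥-elim (avoids k′<j (≰⇒> k≰j) k<r r<n fj<fr fr<fk′ (split l≤k′ k′<k ≤-refl k<r))

        -- By above-last-onwards, the left-part entries below f r form a prefix of the left
        -- part; split at its end, or just before r if that prefix is empty.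
        splits-extend : ∀ {l k r} → l < k → k < r → r < n → Splits R l k r →
          ∃ λ k′ → l < k′ × k′ < suc r × (Splits R l k′ (suc r) ⊎ Splits (flip R) l k′ (suc r))
        splits-extend {l} {k} {r} l<k k<r r<n split
          with first-in-range (λ j → f r R? f j) l k
        ... | inj₁ none =
          k , l<k , m<n⇒m<1+n k<r ,
          inj₁ (splits-extendʳ R split λ l≤i i<k →
                  below-of-not-above (<-trans i<k k<r) r<n (none l≤i i<k))
        ... | inj₂ (k′ , l≤k′ , k′<k , fr<fk′ , first) with m≤n⇒m<n∨m≡n l≤k′
        ...   | inj₂ refl =
          r , <-trans l<k k<r , n<1+n r ,
          inj₂ (splits-extendʳ (flip R) (splits-nothing {flip R}) above)
          where
          above : ∀ {i} → l ≤ i → i < r → R (f r) (f i)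
          above = above-last-onwards split k<r r<n l≤k′ k′<k fr<fk′
        ...   | inj₁ l<k′ =
          k′ , l<k′ , m<n⇒m<1+n (<-trans k′<k k<r) , inj₁ (splits-extendʳ R through below)
          where
          below : ∀ {i} → l ≤ i → i < k′ → R (f i) (f r)
          below l≤i i<k′ = below-of-not-above (<-trans i<k′ (<-trans k′<k k<r)) r<n (first l≤i i<k′)
          through : Splits R l k′ r
          through l≤i i<k′ k′≤j j<r =
            R-trans (below l≤i i<k′) (above-last-onwards split k<r r<n l≤k′ k′<k fr<fk′ k′≤j j<r)

    module _ (avoids3142 : Avoids3142 _<_) (avoids2413 : Avoids3142 _>_) where

      decompose : ∀ {l} r → suc l < r → r ≤ n → ∃ λ k → l < k × k < r × Separates l k r
      decompose {l} (suc r) l<r r<n with m≤n⇒m<n∨m≡n (s≤s⁻¹ l<r)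
      ... | inj₂ refl =
        suc l , n<1+n l , n<1+n (suc l) ,
        Sum.map (splits-pair {_<_}) (splits-pair {_>_}) (R-connex <-isStrictTotalOrder (n<1+n l) r<n)
      ... | inj₁ l+1<r with decompose r l+1<r (<⇒≤ r<n)
      ...   | k , l<k , k<r , inj₁ split = splits-extend <-isStrictTotalOrder avoids3142 l<k k<r r<n split
      ...   | k , l<k , k<r , inj₂ split
        with splits-extend (Flip.isStrictTotalOrder <-isStrictTotalOrder) avoids2413 l<k k<r r<n split
      ...     | k′ , l<k′ , k′<r , sep = k′ , l<k′ , k′<r , swap sep

      pair-block : ∀ {l r} → Acc _<_ (r ∸ l) → suc l < r → r ≤ n → Block l r →
        ∃ λ i → suc i < n × Block i (suc (suc i))
      pair-block {l} {r} (acc smaller) l+1<r r≤n block with decompose r l+1<r r≤n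
      ... | k , l<k , k<r , sep with m≤n⇒m<n∨m≡n l<k | m≤n⇒m<n∨m≡n k<r
      ...   | inj₁ l+1<k | _ =
        pair-block (smaller (∸-monoˡ-< k<r (<⇒≤ l<k))) l+1<k (≤-trans (<⇒≤ k<r) r≤n)
          (block-left (<⇒≤ k<r) sep block)
      ...   | inj₂ refl | inj₁ k+1<r =
        pair-block (smaller (∸-monoʳ-< l<k (<⇒≤ k<r))) k+1<r r≤n (block-right (<⇒≤ l<k) sep block)
      ...   | inj₂ refl | inj₂ refl = l , r≤n , block

    pair-block-consecutive : (∀ {i c} → i < n → c < f i → ∃ λ j → j < n × f j ≡ c) →
      ∀ {i} → suc i < n → Block i (suc (suc i)) → f (suc i) ≡ suc (f i) ⊎ f i ≡ suc (f (suc i))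
    pair-block-consecutive closed {i} i+1<n block with <-cmp (f i) (f (suc i))
    ... | tri< fi<fi+1 _ _ =
      inj₁ (two-point-block-consecutive closed block ≤-refl (m<n⇒m<1+n (n<1+n i))
              (n≤1+n i) (n<1+n (suc i)) i+1<n window-of-two fi<fi+1)
    ... | tri≈ _ fi≡fi+1 _ = ⊥-elim (f-distinct (n<1+n i) i+1<n fi≡fi+1)
    ... | tri> _ _ fi+1<fi =
      inj₂ (two-point-block-consecutive closed block (n≤1+n i) (n<1+n (suc i))
              ≤-refl (m<n⇒m<1+n (n<1+n i)) (<-trans (n<1+n i) i+1<n)
              (λ i≤j j<i+2 → swap (window-of-two i≤j j<i+2)) fi+1<fi)

module Entries {n : ℕ} (σ : Permutation′ n) where

  -- Positions at or beyond n get the junk entry 0.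
  entry : ℕ → ℕ
  entry i with i <? n
  ... | yes i<n = toℕ (σ ⟨$⟩ʳ fromℕ< i<n)
  ... | no _    = 0

  entry-< : ∀ {i} (i<n : i < n) → entry i ≡ toℕ (σ ⟨$⟩ʳ fromℕ< i<n)
  entry-< {i} i<n with i <? n
  ... | yes _   = refl
  ... | no i≮n = ⊥-elim (i≮n i<n)

  entry-injective : ∀ {i j} → i < n → j < n → entry i ≡ entry j → i ≡ j
  entry-injective i<n j<n ei≡ej =
    fromℕ<-injective _ _ i<n j<n (Injection.injective (Inverse⇒Injection σ) (toℕ-injective
      (trans (sym (entry-< i<n)) (trans ei≡ej (entry-< j<n)))))

  entry-image-closed : ∀ {i c} → i < n → c < entry i → ∃ λ j → j < n × entry j ≡ c
  entry-image-closed {i} {c} i<n c<ei = toℕ j , toℕ<n j , (begin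
    entry (toℕ j)                  ≡⟨ entry-< (toℕ<n j) ⟩
    toℕ (σ ⟨$⟩ʳ fromℕ< (toℕ<n j)) ≡⟨ cong (λ x → toℕ (σ ⟨$⟩ʳ x)) (fromℕ<-toℕ j (toℕ<n j)) ⟩
    toℕ (σ ⟨$⟩ʳ j)                ≡⟨ cong toℕ (inverseʳ σ) ⟩
    toℕ (fromℕ< c<n)               ≡⟨ toℕ-fromℕ< c<n ⟩
    c                              ∎)
    where
    open ≡-Reasoning
    c<n : c < n
    c<n = <-trans (subst (c <_) (entry-< i<n) c<ei) (toℕ<n _)
    j : Fin n
    j = σ ⟨$⟩ˡ fromℕ< c<n

  open Windows n entry using (Avoids3142)

  fromℕ<-mono : ∀ {i j} (i<n : i < n) (j<n : j < n) → i < j → fromℕ< i<n Fin.< fromℕ< j<n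
  fromℕ<-mono i<n j<n = subst₂ _<_ (sym (toℕ-fromℕ< i<n)) (sym (toℕ-fromℕ< j<n))

  entry-mono : ∀ {i j} (i<n : i < n) (j<n : j < n) → entry i < entry j →
    σ ⟨$⟩ʳ fromℕ< i<n Fin.< σ ⟨$⟩ʳ fromℕ< j<n
  entry-mono i<n j<n = subst₂ _<_ (entry-< i<n) (entry-< j<n)

  module _ (separable : Separable σ) where

    entry-avoids3142 : Avoids3142 _<_
    entry-avoids3142 i₁<i₂ i₂<i₃ i₃<i₄ i₄<n e₂<e₄ e₄<e₁ e₁<e₃ = proj₂ separable
      ( fromℕ< i₁<n , fromℕ< i₂<n , fromℕ< i₃<n , fromℕ< i₄<n
      , fromℕ<-mono i₁<n i₂<n i₁<i₂ , fromℕ<-mono i₂<n i₃<n i₂<i₃ , fromℕ<-mono i₃<n i₄<n i₃<i₄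
      , entry-mono i₂<n i₄<n e₂<e₄ , entry-mono i₄<n i₁<n e₄<e₁ , entry-mono i₁<n i₃<n e₁<e₃ )
      where
      i₃<n = <-trans i₃<i₄ i₄<n
      i₂<n = <-trans i₂<i₃ i₃<n
      i₁<n = <-trans i₁<i₂ i₂<n

    entry-avoids2413 : Avoids3142 _>_
    entry-avoids2413 i₁<i₂ i₂<i₃ i₃<i₄ i₄<n e₄<e₂ e₁<e₄ e₃<e₁ = proj₁ separable
      ( fromℕ< i₁<n , fromℕ< i₂<n , fromℕ< i₃<n , fromℕ< i₄<n
      , fromℕ<-mono i₁<n i₂<n i₁<i₂ , fromℕ<-mono i₂<n i₃<n i₂<i₃ , fromℕ<-mono i₃<n i₄<n i₃<i₄
      , entry-mono i₃<n i₁<n e₃<e₁ , entry-mono i₁<n i₄<n e₁<e₄ , entry-mono i₄<n i₂<n e₄<e₂ )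
      where
      i₃<n = <-trans i₃<i₄ i₄<n
      i₂<n = <-trans i₂<i₃ i₃<n
      i₁<n = <-trans i₁<i₂ i₂<n

  one-box-at : ∀ {i} (i+1<n : suc i < n) →
    entry (suc i) ≡ suc (entry i) ⊎ entry i ≡ suc (entry (suc i)) →
    OneBoxAt σ (fromℕ< (<-trans (n<1+n i) i+1<n))
  one-box-at {i} i+1<n consecutive = inj₁
    ( fromℕ< i+1<n
    , trans (toℕ-fromℕ< i+1<n) (cong suc (sym (toℕ-fromℕ< i<n)))
    , swap (Sum.map (entry-suc i+1<n i<n) (entry-suc i<n i+1<n) consecutive) )
    where
    i<n = <-trans (n<1+n i) i+1<n
    entry-suc : ∀ {a b} (a<n : a < n) (b<n : b < n) → entry a ≡ suc (entry b) →
      toℕ (σ ⟨$⟩ʳ fromℕ< a<n) ≡ suc (toℕ (σ ⟨$⟩ʳ fromℕ< b<n))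
    entry-suc a<n b<n = subst₂ (λ x y → x ≡ suc y) (entry-< a<n) (entry-< b<n)

theorem8 : (n : ℕ) → 2 ≤ n → (σ : Permutation′ n) → Separable σ →
    ∃ λ (i : Fin n) → OneBoxAt σ i
theorem8 n 2≤n σ separable =
  let i , i+1<n , block = pair-block entry-injective
                            (entry-avoids3142 separable) (entry-avoids2413 separable)
                            (<-wellFounded n) 2≤n ≤-refl whole-block
  in _ , one-box-at i+1<n (pair-block-consecutive entry-injective entry-image-closed i+1<n block)
  where
  open Entries σ
  open Windows n entry
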